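{- Let $(\mathcal{Y},\eta)$ be an $(n,m)$-voltage operator and $\mathcal{X}$ an $n$-premaniplex such that $\mathcal{X}\rtimes_\eta\mathcal{Y}$ is connected. Let $\gamma\in\mathrm{Aut}(\mathcal{X}\rtimes_\eta\mathcal{Y})$ and $\tau\in\mathrm{Aut}(\mathcal{Y})$. If for some flag $(x_0,y_0)\in\mathcal{X}\rtimes_\eta\mathcal{Y}$ and some $x_1\in\mathcal{X}$ we have $(x_0,y_0)\gamma=(x_1,y_0\tau)$, then $\gamma$ is a lift of $\tau$.
   Context: A graph may have multiple edges and semi-edges. An $n$-premaniplex is such a graph with edges coloured by $\{0,\dots,n-1\}$ so that every vertex (flag) is the starting point of exactly one dart of each colour, and whenever $|i-j|\ge2$ every alternating path of length 4 with colours $i,j$ is closed; $x^i$ is the end of the $i$-dart at $x$. $\mathcal{C}^n=\langle r_0,\dots,r_{n-1}\mid r_i^2=1,\ (r_ir_j)^2=1\ (|i-j|\ge2)\rangle$ acts on the left on flags by $r_ix=x^i$. Automorphisms are bijections of flags preserving all $i$-adjacencies, acting on the right. For a flag $y$ of an $m$-premaniplex $\mathcal{Y}$ and $\omega\in\mathcal{C}^m$, $P_\omega(y)$ is the homotopy class of paths from $y$ whose successive colours $i_1,\dots,i_k$ satisfy $r_{i_k}\cdots r_{i_1}=\omega$ (homotopic iff same start and same element of $\mathcal{C}^m$); these form the fundamental groupoid $\Pi(\mathcal{Y})$. A voltage assignment $\eta:\Pi(\mathcal{Y})\to\mathcal{C}^n$ satisfies $\eta(W_1W_2)=\eta(W_2)\eta(W_1)$;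 $(\mathcal{Y},\eta)$ is an $(n,m)$-voltage operator. $\mathcal{X}\rtimes_\eta\mathcal{Y}$ is the $m$-premaniplex with flags $\mathcal{X}\times\mathcal{Y}$ and $(x,y)^i=(\eta(P_{r_i}(y))x,y^i)$, so $\omega(x,y)=(\eta(P_\omega(y))x,\omega y)$. An automorphism $\tilde\tau$ of $\mathcal{X}\rtimes_\eta\mathcal{Y}$ is a lift of $\tau\in\mathrm{Aut}(\mathcal{Y})$ if for every flag $(x,y)$ the second coordinate of $(x,y)\tilde\tau$ is $y\tau$. Standing assumption: $\mathcal{Y}$ has a spanning tree (forest if disconnected) all of whose darts have trivial voltage. -}

module Defs where

open import Data.Nat using (ℕ; _≤_; ∣_-_∣)
open import Data.Fin using (Fin; toℕ)
open import Data.List using (List; []; _∷_; _++_; [_])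
open import Data.List.Relation.Unary.All using (All)
open import Data.Product using (Σ; _×_; _,_; proj₁; proj₂; ∃)
open import Data.Empty using (⊥)
open import Relation.Binary.PropositionalEquality using (_≡_)
open import Function.Bundles using (_↔_; Inverse)

Far : ∀ {n} → Fin n → Fin n → Set
Far i j = 2 ≤ ∣ toℕ i - toℕ j ∣

-- A word [i₁, …, i_k] (a list of colours, read in path order) denotes the
-- element r_{i_k} ⋯ r_{i₁} of C^n.  Hence concatenation  u ++ v  denotes
-- (element of v)(element of u), exactly like concatenation of paths.

Word : ℕ → Set
Word n = List (Fin n)

infix 4 _≈C_
data _≈C_ {n : ℕ} : Word n → Word n → Set where
  ≈-refl  : ∀ {u} → u ≈C u
  ≈-sym   : ∀ {u v} → u ≈C v → v ≈C u
  ≈-trans : ∀ {u v w} → u ≈C v → v ≈C w → u ≈C w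
  rel-ii  : ∀ u v (i : Fin n) → (u ++ i ∷ i ∷ v) ≈C (u ++ v)
  rel-far : ∀ u v (i j : Fin n) → Far i j →
            (u ++ i ∷ j ∷ i ∷ j ∷ v) ≈C (u ++ v)

-- Flag graphs (properly n-edge-coloured graphs, possibly with multiple
-- edges and semi-edges): every flag has exactly one i-dart, ending at x^i.

record FlagGraph (n : ℕ) : Set₁ where
  field
    Flag : Set
    adj  : Fin n → Flag → Flag
  act : Word n → Flag → Flag
  act []      x = x
  act (i ∷ l) x = act l (adj i x)

record Premaniplex (n : ℕ) : Set₁ where
  field
    graph    : FlagGraph n
  open FlagGraph graph public
  field
    adj-invol : ∀ (i : Fin n) x → adj i (adj i x) ≡ x
    adj-far   : ∀ (i j : Fin n) → Far i j → ∀ x →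
                adj j (adj i (adj j (adj i x))) ≡ x

open FlagGraph public using (Flag; adj; act)

Connected : ∀ {n} → FlagGraph n → Set
Connected G = ∀ (a b : Flag G) → ∃ λ (w : Word _) → act G w a ≡ b

-- Automorphisms: bijections of flags preserving all i-adjacencies
-- (acting on the right; x γ is written  Inverse.to γ x).
record Aut {n} (G : FlagGraph n) : Set where
  field
    bij      : Flag G ↔ Flag G
  open Inverse bij public using (to; from)
  field
    preserve : ∀ (i : Fin n) x → to (adj G i x) ≡ adj G i (to x)

-- A path from y with successive colours l lies in the
-- homotopy class P_ω(y) with ω the element denoted by l; two paths are
-- homotopic iff same start and l ≈C l'.  A voltage assignment is thus a
-- function on (start, word) that is well defined on homotopy classes and
-- satisfies η(W₁W₂) = η(W₂)η(W₁), which in the word convention reads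
--   η y (l₁ ++ l₂) ≈ η y l₁ ++ η (l₁ y) l₂.

record VoltageOperator (n m : ℕ) : Set₁ where
  field
    Y      : Premaniplex m
  open Premaniplex Y using () renaming (Flag to FY; act to actY)
  field
    η      : FY → Word m → Word n
    η-homotopy : ∀ y {l l'} → l ≈C l' → η y l ≈C η y l'
    η-anti     : ∀ y l₁ l₂ → η y (l₁ ++ l₂) ≈C (η y l₁ ++ η (actY l₁ y) l₂)

_⋊_ : ∀ {n m} → Premaniplex n → VoltageOperator n m → FlagGraph m
X ⋊ V = record
  { Flag = Flag X.graph × Flag Y.graph
  ; adj  = λ i xy → act X.graph (η (proj₂ xy) [ i ]) (proj₁ xy) , adj Y.graph i (proj₂ xy)
  }
  where
    module X = Premaniplex X
    open VoltageOperator V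
    module Y = Premaniplex Y

IsLift : ∀ {n m} {X : Premaniplex n} {V : VoltageOperator n m} →
         Aut (X ⋊ V) → Aut (Premaniplex.graph (VoltageOperator.Y V)) → Set
IsLift {X = X} {V} γ τ =
  ∀ (x : Flag (Premaniplex.graph X)) (y : Flag (Premaniplex.graph (VoltageOperator.Y V))) →
    proj₂ (Aut.to γ (x , y)) ≡ Aut.to τ y

-- A set T of darts (y,i) (dart from y to y^i) is a
-- spanning forest if it is closed under reversing darts, every two flags
-- in the same component are joined by a path of T-darts, and it contains
-- no cycle, i.e. no nonempty closed path of T-darts without backtracking
-- (backtracking = two consecutive darts of the same colour).

InTree : ∀ {m} (G : FlagGraph m) → (Flag G → Fin m → Set) → Flag G → Word m → Set
InTree G T y []      = Data.Unit.⊤ where import Data.Unit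
InTree G T y (i ∷ l) = T y i × InTree G T (adj G i y) l

NoBacktrack : ∀ {m} → Word m → Set
NoBacktrack []          = Data.Unit.⊤ where import Data.Unit
NoBacktrack (i ∷ [])    = Data.Unit.⊤ where import Data.Unit
NoBacktrack (i ∷ j ∷ l) = (i ≡ j → ⊥) × NoBacktrack (j ∷ l)

record IsSpanningForest {m} (G : FlagGraph m) (T : Flag G → Fin m → Set) : Set where
  field
    symmetric : ∀ y i → T y i → T (adj G i y) i
    spanning  : ∀ y (l : Word m) → ∃ λ l' → InTree G T y l' × act G l' y ≡ act G l y
    acyclic   : ∀ y (i : Fin m) (l : Word m) → InTree G T y (i ∷ l) →
                NoBacktrack (i ∷ l) → act G (i ∷ l) y ≡ y → ⊥

HasTrivialSpanningForest : ∀ {n m} → VoltageOperator n m → Set₁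
HasTrivialSpanningForest {n} {m} V =
  Σ (Flag G → Fin m → Set) λ T →
    IsSpanningForest G T × (∀ y i → T y i → η y [ i ] ≈C [])
  where
    open VoltageOperator V
    G = Premaniplex.graph Y

-- Projecting to Y after γ and applying τ after projecting are both
-- colour-preserving maps from X ⋊ Y to Y, and they agree at (x₀, y₀).
-- Colour-preserving maps commute with the action of words, so on a
-- connected flag graph two of them that agree at one flag agree everywhere.
{-# OPTIONS --safe #-}
module Submission where

open import Defs
open import Data.Product using (_,_; proj₂)
open import Data.List using ([]; _∷_)
open import Relation.Binary.PropositionalEquality
  using (_≡_; refl; trans; cong; module ≡-Reasoning)

record IsColourPreserving {n} (G H : FlagGraph n) (f : Flag G → Flag H) : Set where
  field
    preserves-adj : ∀ i x → f (adj G i x) ≡ adj H i (f x)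

open IsColourPreserving

act-natural : ∀ {n} {G H : FlagGraph n} {f : Flag G → Flag H} →
  IsColourPreserving G H f → ∀ w x → f (act G w x) ≡ act H w (f x)
act-natural f-pres []      x = refl
act-natural {G = G} {H} {f} f-pres (i ∷ w) x = begin
  f (act G w (adj G i x))   ≡⟨ act-natural f-pres w (adj G i x) ⟩
  act H w (f (adj G i x))   ≡⟨ cong (act H w) (preserves-adj f-pres i x) ⟩
  act H w (adj H i (f x))   ∎
  where open ≡-Reasoning

colourPreserving-unique : ∀ {n} {G H : FlagGraph n} {f g : Flag G → Flag H} →
  Connected G → IsColourPreserving G H f → IsColourPreserving G H g →
  ∀ a → f a ≡ g a → ∀ b → f b ≡ g b
colourPreserving-unique {G = G} {H} {f} {g} conn f-pres g-pres a fa≡ga b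
  with conn a b
... | w , refl = begin
  f (act G w a)   ≡⟨ act-natural f-pres w a ⟩
  act H w (f a)   ≡⟨ cong (act H w) fa≡ga ⟩
  act H w (g a)   ≡⟨ act-natural g-pres w a ⟨
  g (act G w a)   ∎
  where open ≡-Reasoning

∘-colourPreserving : ∀ {n} {G H K : FlagGraph n} {f : Flag G → Flag H} {g : Flag H → Flag K} →
  IsColourPreserving G H f → IsColourPreserving H K g →
  IsColourPreserving G K (λ x → g (f x))
∘-colourPreserving {g = g} f-pres g-pres .preserves-adj i x =
  trans (cong g (preserves-adj f-pres i x)) (preserves-adj g-pres i _)

Aut-colourPreserving : ∀ {n} {G : FlagGraph n} (γ : Aut G) → IsColourPreserving G G (Aut.to γ)
Aut-colourPreserving γ .preserves-adj = Aut.preserve γ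

proj₂-colourPreserving : ∀ {n m} (V : VoltageOperator n m) (X : Premaniplex n) →
  IsColourPreserving (X ⋊ V) (Premaniplex.graph (VoltageOperator.Y V)) proj₂
proj₂-colourPreserving V X .preserves-adj i x = refl

lemma6p9 : ∀ {n m} (V : VoltageOperator n m) (X : Premaniplex n) →
    HasTrivialSpanningForest V →
    Connected (X ⋊ V) →
    (γ : Aut (X ⋊ V)) (τ : Aut (Premaniplex.graph (VoltageOperator.Y V))) →
    (x₀ : Flag (Premaniplex.graph X)) (y₀ : Flag (Premaniplex.graph (VoltageOperator.Y V)))
    (x₁ : Flag (Premaniplex.graph X)) →
    Aut.to γ (x₀ , y₀) ≡ (x₁ , Aut.to τ y₀) →
    IsLift {X = X} {V = V} γ τ
lemma6p9 V X _ conn γ τ x₀ y₀ x₁ γ-at-base x y =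
  colourPreserving-unique conn
    (∘-colourPreserving (Aut-colourPreserving γ) (proj₂-colourPreserving V X))
    (∘-colourPreserving (proj₂-colourPreserving V X) (Aut-colourPreserving τ))
    (x₀ , y₀) (cong proj₂ γ-at-base) (x , y)
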